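{- Let $a\in\{\tfrac12,-\tfrac12\}$ and let $n\ge 2$ be an integer. Then the polynomial $K_{a,n}(x)=x^n+(1-x)^n+a^n$ is irreducible over $\mathbb{Q}$. -}

module Defs where

open import Data.Nat using (ℕ; zero; suc)
open import Data.Rational using (ℚ; 0ℚ; 1ℚ; _+_; _*_; -_)
open import Data.List using (List; []; _∷_; map)
open import Data.Product using (Σ; _×_)
open import Data.Sum using (_⊎_)
open import Relation.Nullary using (¬_)
open import Relation.Binary.PropositionalEquality using (_≡_)

-- Polynomials in ℚ[x] as coefficient lists, lowest degree first
-- (trailing zero coefficients allowed; equality is coefficientwise).
Poly : Set
Poly = List ℚ

coeff : Poly → ℕ → ℚ
coeff []      _       = 0ℚ
coeff (a ∷ p) zero    = a
coeff (a ∷ p) (suc k) = coeff p k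

infix 4 _≈ₚ_
_≈ₚ_ : Poly → Poly → Set
p ≈ₚ q = ∀ k → coeff p k ≡ coeff q k

infixl 6 _+ₚ_
_+ₚ_ : Poly → Poly → Poly
[]      +ₚ q       = q
(a ∷ p) +ₚ []      = a ∷ p
(a ∷ p) +ₚ (b ∷ q) = (a + b) ∷ (p +ₚ q)

infixl 7 _*ₚ_
_*ₚ_ : Poly → Poly → Poly
[]      *ₚ q = []
(a ∷ p) *ₚ q = map (a *_) q +ₚ (0ℚ ∷ (p *ₚ q))

C : ℚ → Poly
C c = c ∷ []

X : Poly
X = 0ℚ ∷ 1ℚ ∷ []

-ₚ_ : Poly → Poly
-ₚ p = map -_ p

infixr 8 _^ₚ_
_^ₚ_ : Poly → ℕ → Poly
p ^ₚ zero  = C 1ℚ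
p ^ₚ suc n = p *ₚ (p ^ₚ n)

infixr 8 _^_
_^_ : ℚ → ℕ → ℚ
c ^ zero  = 1ℚ
c ^ suc n = c * (c ^ n)

IsUnit : Poly → Set
IsUnit p = Σ Poly λ q → p *ₚ q ≈ₚ C 1ℚ

Irreducible : Poly → Set
Irreducible f = ¬ (f ≈ₚ []) × ¬ IsUnit f ×
  (∀ g h → f ≈ₚ g *ₚ h → IsUnit g ⊎ IsUnit h)

K : ℚ → ℕ → Poly
K a n = X ^ₚ n +ₚ (C 1ℚ +ₚ -ₚ X) ^ₚ n +ₚ C (a ^ n)

-- With v the 2-adic valuation and a = ±½, the constant term 1 + aⁿ of K has valuation −n, all
-- other coefficients are integers, and the leading coefficient is 2, of valuation 1, when n is even
-- (degree N = n), and n, of valuation 0, when n is odd (xⁿ cancels, degree N = n − 1). So the points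
-- (k, v Kₖ) lie on or above the line through (0, −n) of slope (N + 1)/N and meet it only at k = 0
-- and k = N: the Newton polygon is one segment without interior lattice points, and Dumas' criterion
-- applies. It is proved with the weight w(c xᵏ) = N v(c) − (N + 1) k: if K = g h, the highest indices
-- at which g and h attain their minimal weights add up to N, and g attains its minimal weight at 0
-- and at its index i, so N ∣ (N + 1) i and i ∈ {0, N}; one factor then has degree 0.

module Submission where

open import Defs
open import Data.Nat.Base as ℕ using (ℕ; zero; suc; _+_; _*_; _≤_; _<_; z≤n; s≤s)
import Data.Nat.Properties as ℕₚ
open import Data.Nat.Divisibility using (_∣_; divides; ∣-trans; m∣m*n; ∣⇒≤)
open import Data.Nat.Induction using (<-rec)
open import Data.Nat.Tactic.RingSolver using () renaming (solve-∀ to ℕ-solve-∀)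
open import Data.Integer.Base as ℤ using (ℤ; +_; -[1+_]; +[1+_]; +≤+; -≤+; ∣_∣; 0ℤ; 1ℤ; -1ℤ)
import Data.Integer.Properties as ℤₚ
import Data.Integer.Divisibility.Signed as ℤ∣
open import Data.Integer.Tactic.RingSolver using (solve-∀)
open import Data.Rational.Base as ℚ using (ℚ; mkℚ; 0ℚ; 1ℚ; ½; -½; toℚᵘ)
import Data.Rational.Properties as ℚₚ
open import Data.Rational.Literals using (fromℤ)
open import Data.Rational.Unnormalised.Base as ℚᵘ using (ℚᵘ; mkℚᵘ; ↥_; ↧_; ↧ₙ_; *≡*)
import Data.Rational.Unnormalised.Properties as ℚᵘₚ
open import Algebra.Properties.Group ℚₚ.+-0-group using (inverseʳ-unique)
open import Data.List.Base using ([]; _∷_; map)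
open import Data.Empty using (⊥)
open import Data.Product using (∃-syntax; _×_; _,_; proj₁; proj₂)
open import Data.Sum as Sum using (_⊎_; inj₁; inj₂; [_,_]′)
open import Function using (_∘_; _$_)
open import Relation.Binary.PropositionalEquality
open import Relation.Binary.Definitions using (tri<; tri≈; tri>)
open import Relation.Nullary using (¬_; yes; no; contradiction)

Odd : ℕ → Set
Odd u = ∃[ t ] u ≡ suc (t + t)

even⊎odd : ∀ n → (∃[ m ] n ≡ m + m) ⊎ Odd n
even⊎odd zero = inj₁ (0 , refl)
even⊎odd (suc n) with even⊎odd n
... | inj₁ (m , refl) = inj₂ (m , refl)
... | inj₂ (t , refl) = inj₁ (suc t , cong suc (sym (ℕₚ.+-suc t t)))

odd≢even : ∀ t s → suc (t + t) ≢ s + s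
odd≢even t       zero    ()
odd≢even zero    (suc s) e = contradiction (trans e (ℕₚ.+-suc (suc s) s)) λ ()
odd≢even (suc t) (suc s) e =
  odd≢even t s (ℕₚ.suc-injective (trans (cong suc (sym (ℕₚ.+-suc t t))) (trans (ℕₚ.suc-injective e) (ℕₚ.+-suc s s))))

odd-* : ∀ {u w} → Odd u → Odd w → Odd (u * w)
odd-* (t , refl) (s , refl) = t + s + (t * s + t * s) , expand t s
  where
  expand : ∀ t s → suc (t + t) * suc (s + s) ≡ suc (t + s + (t * s + t * s) + (t + s + (t * s + t * s)))
  expand = ℕ-solve-∀

odd≢0 : ∀ {u} → Odd u → u ≢ 0
odd≢0 (t , refl) ()

2^≢0 : ∀ k → 2 ℕ.^ k ≢ 0
2^≢0 k = ℕ.≢-nonZero⁻¹ (2 ℕ.^ k) {{ℕₚ.m^n≢0 2 k}}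

2^k*odd≢0 : ∀ k {u} → Odd u → 2 ℕ.^ k * u ≢ 0
2^k*odd≢0 k o e with ℕₚ.m*n≡0⇒m≡0∨n≡0 (2 ℕ.^ k) e
... | inj₁ 2^k≡0 = 2^≢0 k 2^k≡0
... | inj₂ u≡0   = odd≢0 o u≡0

[2*m]*n≡m*n+m*n : ∀ m n → (2 * m) * n ≡ m * n + m * n
[2*m]*n≡m*n+m*n = ℕ-solve-∀

record OddDecomposition (n : ℕ) : Set where
  constructor decomposition
  field
    exponent : ℕ
    oddPart  : ℕ
    odd      : Odd oddPart
    equation : n ≡ 2 ℕ.^ exponent * oddPart

oddDecomposition : ∀ n → n ≢ 0 → OddDecomposition n
oddDecomposition = <-rec _ step
  where
  step : ∀ n → (∀ {m} → m < n → m ≢ 0 → OddDecomposition m) → n ≢ 0 → OddDecomposition n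
  step n rec n≢0 with even⊎odd n
  ... | inj₂ o = decomposition 0 n o (sym (ℕₚ.+-identityʳ n))
  ... | inj₁ (zero , refl) = contradiction refl n≢0
  ... | inj₁ (m@(suc _) , refl) with rec (ℕₚ.m<m+n m {m} ℕₚ.0<1+n) (λ ())
  ...   | decomposition k u o e = decomposition (suc k) u o (trans (cong (λ x → x + x) e) (sym ([2*m]*n≡m*n+m*n (2 ℕ.^ k) u)))

exponent-unique : ∀ k k′ {u u′} → Odd u → Odd u′ → 2 ℕ.^ k * u ≡ 2 ℕ.^ k′ * u′ → k ≡ k′
exponent-unique zero    zero     _          _          _ = refl
exponent-unique zero    (suc k′) (t , refl) _          e =
  contradiction (trans e ([2*m]*n≡m*n+m*n (2 ℕ.^ k′) _)) (odd≢even t (2 ℕ.^ k′ * _) ∘ trans (sym (ℕₚ.+-identityʳ _)))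
exponent-unique (suc k) zero     _          (t , refl) e =
  contradiction (trans (sym e) ([2*m]*n≡m*n+m*n (2 ℕ.^ k) _)) (odd≢even t (2 ℕ.^ k * _) ∘ trans (sym (ℕₚ.+-identityʳ _)))
exponent-unique (suc k) (suc k′) o          o′         e =
  cong suc (exponent-unique k k′ o o′ (ℕₚ.*-cancelˡ-≡ _ _ 2
    (trans (sym (ℕₚ.*-assoc 2 (2 ℕ.^ k) _)) (trans e (ℕₚ.*-assoc 2 (2 ℕ.^ k′) _)))))

-- Opaque, since unfolding it exposes the well-founded recursion of oddDecomposition; ν 0 = 0
-- is a junk value.
opaque
  ν : ℕ → ℕ
  ν zero        = 0
  ν n@(suc _) = OddDecomposition.exponent (oddDecomposition n ℕₚ.1+n≢0)

  ν-decomposition : ∀ {n} → n ≢ 0 → ∃[ u ] Odd u × n ≡ 2 ℕ.^ ν n * u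
  ν-decomposition {zero}  n≢0 = contradiction refl n≢0
  ν-decomposition {suc n} _   = oddPart , odd , equation
    where open OddDecomposition (oddDecomposition (suc n) ℕₚ.1+n≢0)

ν-unique : ∀ {n k u} → Odd u → n ≡ 2 ℕ.^ k * u → ν n ≡ k
ν-unique {k = k} o e with ν-decomposition (2^k*odd≢0 k o ∘ trans (sym e))
... | u′ , o′ , e′ = exponent-unique _ k o′ o (trans (sym e′) e)

ν-odd : ∀ {u} → Odd u → ν u ≡ 0
ν-odd o = ν-unique o (sym (ℕₚ.+-identityʳ _))

ν-2^ : ∀ k → ν (2 ℕ.^ k) ≡ k
ν-2^ k = ν-unique (0 , refl) (sym (ℕₚ.*-identityʳ (2 ℕ.^ k)))

ν-* : ∀ {m n} → m ≢ 0 → n ≢ 0 → ν (m * n) ≡ ν m + ν n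
ν-* {m} {n} m≢0 n≢0 with ν-decomposition m≢0 | ν-decomposition n≢0
... | u , o , e | w , o′ , e′ = ν-unique (odd-* o o′) (begin
  m * n                                       ≡⟨ cong₂ _*_ e e′ ⟩
  (2 ℕ.^ ν m * u) * (2 ℕ.^ ν n * w)           ≡⟨ interchange (2 ℕ.^ ν m) (2 ℕ.^ ν n) u w ⟩
  (2 ℕ.^ ν m * 2 ℕ.^ ν n) * (u * w)           ≡⟨ cong (_* (u * w)) (ℕₚ.^-distribˡ-+-* 2 (ν m) (ν n)) ⟨
  2 ℕ.^ (ν m + ν n) * (u * w)                 ∎)
  where
  open ≡-Reasoning
  interchange : ∀ a b u w → (a * u) * (b * w) ≡ (a * b) * (u * w)
  interchange = ℕ-solve-∀

2^ν∣ : ∀ n → 2 ℕ.^ ν n ∣ n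
2^ν∣ zero    = divides 0 refl
2^ν∣ (suc n) with ν-decomposition ℕₚ.1+n≢0
... | u , _ , e = divides u (trans e (ℕₚ.*-comm _ u))

2^∣⇒≤ν : ∀ {c n} → n ≢ 0 → 2 ℕ.^ c ∣ n → c ≤ ν n
2^∣⇒≤ν {c} {n} n≢0 (divides q refl) = begin
  c                     ≤⟨ ℕₚ.m≤m+n c (ν q) ⟩
  c + ν q               ≡⟨ cong (_+ ν q) (ν-2^ c) ⟨
  ν (2 ℕ.^ c) + ν q     ≡⟨ ν-* (2^≢0 c) (λ q≡0 → n≢0 (cong (_* 2 ℕ.^ c) q≡0)) ⟨
  ν (2 ℕ.^ c * q)       ≡⟨ cong ν (ℕₚ.*-comm (2 ℕ.^ c) q) ⟩
  ν (q * 2 ℕ.^ c)       ∎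
  where open ℕₚ.≤-Reasoning

≤ν⇒2^∣ : ∀ {c n} → c ≤ ν n → 2 ℕ.^ c ∣ n
≤ν⇒2^∣ {c} {n} c≤ν with ℕₚ.m≤n⇒∃[o]m+o≡n c≤ν
... | d , c+d≡ν = ∣-trans (subst (2 ℕ.^ c ∣_) 2^c*2^d≡2^ν (m∣m*n (2 ℕ.^ d))) (2^ν∣ n)
  where
  2^c*2^d≡2^ν : 2 ℕ.^ c * 2 ℕ.^ d ≡ 2 ℕ.^ ν n
  2^c*2^d≡2^ν = trans (sym (ℕₚ.^-distribˡ-+-* 2 c d)) (cong (2 ℕ.^_) c+d≡ν)

νℤ : ℤ → ℕ
νℤ x = ν ∣ x ∣

∣i∣≢0 : ∀ {i} → i ≢ 0ℤ → ∣ i ∣ ≢ 0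
∣i∣≢0 i≢0 = i≢0 ∘ ℤₚ.∣i∣≡0⇒i≡0

i*j≢0 : ∀ {i j} → i ≢ 0ℤ → j ≢ 0ℤ → i ℤ.* j ≢ 0ℤ
i*j≢0 {i} i≢0 j≢0 ij≡0 with ℤₚ.i*j≡0⇒i≡0∨j≡0 i ij≡0
... | inj₁ i≡0 = i≢0 i≡0
... | inj₂ j≡0 = j≢0 j≡0

νℤ-* : ∀ {x y} → x ≢ 0ℤ → y ≢ 0ℤ → νℤ (x ℤ.* y) ≡ νℤ x ℕ.+ νℤ y
νℤ-* {x} {y} x≢0 y≢0 = trans (cong ν (ℤₚ.abs-* x y)) (ν-* (∣i∣≢0 x≢0) (∣i∣≢0 y≢0))

νℤ-+ : ∀ {c x y} → x ℤ.+ y ≢ 0ℤ → c ℤ.≤ + νℤ x → c ℤ.≤ + νℤ y → c ℤ.≤ + νℤ (x ℤ.+ y)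
νℤ-+ { -[1+ _ ]} _ _ _ = -≤+
νℤ-+ {+ c} {x} {y} x+y≢0 (+≤+ c≤νx) (+≤+ c≤νy) = +≤+ (2^∣⇒≤ν (∣i∣≢0 x+y≢0)
  (ℤ∣.∣⇒∣ᵤ (ℤ∣.∣m∣n⇒∣m+n (ℤ∣.∣ᵤ⇒∣ {+ 2 ℕ.^ c} {x} (≤ν⇒2^∣ c≤νx))
                          (ℤ∣.∣ᵤ⇒∣ {+ 2 ℕ.^ c} {y} (≤ν⇒2^∣ c≤νy)))))

νᵘ : ℚᵘ → ℤ
νᵘ p = + νℤ (↥ p) ℤ.- + ν (↧ₙ p)

a+d≡b+c⇒a-c≡b-d : ∀ a b c d → a ℕ.+ d ≡ b ℕ.+ c → + a ℤ.- + c ≡ + b ℤ.- + d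
a+d≡b+c⇒a-c≡b-d a b c d e = begin
  + a ℤ.- + c                        ≡⟨ shift (+ a) (+ c) (+ d) ⟩
  (+ a ℤ.+ + d) ℤ.- (+ c ℤ.+ + d)    ≡⟨ cong₂ ℤ._-_ (sym (ℤₚ.pos-+ a d)) (ℤₚ.+-comm (+ c) (+ d)) ⟩
  + (a ℕ.+ d) ℤ.- (+ d ℤ.+ + c)      ≡⟨ cong (λ x → + x ℤ.- (+ d ℤ.+ + c)) e ⟩
  + (b ℕ.+ c) ℤ.- (+ d ℤ.+ + c)      ≡⟨ cong (ℤ._- (+ d ℤ.+ + c)) (ℤₚ.pos-+ b c) ⟩
  (+ b ℤ.+ + c) ℤ.- (+ d ℤ.+ + c)    ≡⟨ shift (+ b) (+ d) (+ c) ⟨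
  + b ℤ.- + d                        ∎
  where
  open ≡-Reasoning
  shift : ∀ a c d → a ℤ.- c ≡ (a ℤ.+ d) ℤ.- (c ℤ.+ d)
  shift = solve-∀

≃-↥≢0 : ∀ {p q} → p ℚᵘ.≃ q → ↥ p ≢ 0ℤ → ↥ q ≢ 0ℤ
≃-↥≢0 {p} {q} (*≡* e) ↥p≢0 ↥q≡0 =
  i*j≢0 ↥p≢0 (λ ()) (trans e (trans (cong (ℤ._* ↧ p) ↥q≡0) (ℤₚ.*-zeroˡ (↧ p))))

νᵘ-cong : ∀ {p q} → p ℚᵘ.≃ q → ↥ p ≢ 0ℤ → νᵘ p ≡ νᵘ q
νᵘ-cong {p} {q} p≃q@(*≡* e) ↥p≢0 = a+d≡b+c⇒a-c≡b-d (νℤ (↥ p)) (νℤ (↥ q)) (ν (↧ₙ p)) (ν (↧ₙ q)) (begin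
  νℤ (↥ p) ℕ.+ ν (↧ₙ q)   ≡⟨ νℤ-* ↥p≢0 (λ ()) ⟨
  νℤ (↥ p ℤ.* ↧ q)        ≡⟨ cong νℤ e ⟩
  νℤ (↥ q ℤ.* ↧ p)        ≡⟨ νℤ-* (≃-↥≢0 p≃q ↥p≢0) (λ ()) ⟩
  νℤ (↥ q) ℕ.+ ν (↧ₙ p)   ∎)
  where open ≡-Reasoning

νᵘ-* : ∀ {p q} → ↥ p ≢ 0ℤ → ↥ q ≢ 0ℤ → νᵘ (p ℚᵘ.* q) ≡ νᵘ p ℤ.+ νᵘ q
νᵘ-* {p@(mkℚᵘ _ _)} {q@(mkℚᵘ _ _)} ↥p≢0 ↥q≢0 = begin
  + νℤ (↥ p ℤ.* ↥ q) ℤ.- + ν (↧ₙ p ℕ.* ↧ₙ q)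
    ≡⟨ cong₂ (λ x y → + x ℤ.- + y) (νℤ-* ↥p≢0 ↥q≢0) (ν-* ℕₚ.1+n≢0 ℕₚ.1+n≢0) ⟩
  + (a ℕ.+ b) ℤ.- + (c ℕ.+ d)
    ≡⟨ cong₂ ℤ._-_ (ℤₚ.pos-+ a b) (ℤₚ.pos-+ c d) ⟩
  (+ a ℤ.+ + b) ℤ.- (+ c ℤ.+ + d)
    ≡⟨ regroup (+ a) (+ b) (+ c) (+ d) ⟩
  (+ a ℤ.- + c) ℤ.+ (+ b ℤ.- + d)    ∎
  where
  open ≡-Reasoning
  a b c d : ℕ
  a = νℤ (↥ p); b = νℤ (↥ q); c = ν (↧ₙ p); d = ν (↧ₙ q)
  regroup : ∀ a b c d → (a ℤ.+ b) ℤ.- (c ℤ.+ d) ≡ (a ℤ.- c) ℤ.+ (b ℤ.- d)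
  regroup = solve-∀

c≤a-b⇒c+b≤a : ∀ {c a} b → c ℤ.≤ a ℤ.- b → c ℤ.+ b ℤ.≤ a
c≤a-b⇒c+b≤a {c} {a} b c≤a-b = begin
  c ℤ.+ b            ≤⟨ ℤₚ.+-monoˡ-≤ b c≤a-b ⟩
  a ℤ.- b ℤ.+ b      ≡⟨ cancel a b ⟩
  a                  ∎
  where
  open ℤₚ.≤-Reasoning
  cancel : ∀ a b → a ℤ.- b ℤ.+ b ≡ a
  cancel = solve-∀

c+b≤a⇒c≤a-b : ∀ {c a} b → c ℤ.+ b ℤ.≤ a → c ℤ.≤ a ℤ.- b
c+b≤a⇒c≤a-b {c} {a} b c+b≤a = begin
  c                  ≡⟨ cancel c b ⟨
  c ℤ.+ b ℤ.- b      ≤⟨ ℤₚ.+-monoˡ-≤ (ℤ.- b) c+b≤a ⟩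
  a ℤ.- b            ∎
  where
  open ℤₚ.≤-Reasoning
  cancel : ∀ c b → c ℤ.+ b ℤ.- b ≡ c
  cancel = solve-∀

νᵘ-+ : ∀ {c p q} → ↥ p ≢ 0ℤ → ↥ q ≢ 0ℤ → ↥ (p ℚᵘ.+ q) ≢ 0ℤ →
       c ℤ.≤ νᵘ p → c ℤ.≤ νᵘ q → c ℤ.≤ νᵘ (p ℚᵘ.+ q)
νᵘ-+ {c} {p@(mkℚᵘ _ _)} {q@(mkℚᵘ _ _)} ↥p≢0 ↥q≢0 ↥p+q≢0 c≤νp c≤νq = c+b≤a⇒c≤a-b (+ ν (↧ₙ p ℕ.* ↧ₙ q)) (begin
  c ℤ.+ + ν (↧ₙ p ℕ.* ↧ₙ q)          ≡⟨ cong (λ x → c ℤ.+ + x) (ν-* ℕₚ.1+n≢0 ℕₚ.1+n≢0) ⟩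
  c ℤ.+ + (dp ℕ.+ dq)                 ≡⟨ cong (λ x → c ℤ.+ x) (ℤₚ.pos-+ dp dq) ⟩
  c ℤ.+ (+ dp ℤ.+ + dq)               ≤⟨ νℤ-+ {x = ↥ p ℤ.* ↧ q} {y = ↥ q ℤ.* ↧ p} ↥p+q≢0 (bound p q c≤νp ↥p≢0)
                                           (subst (ℤ._≤ _) (cong (λ x → c ℤ.+ x) (ℤₚ.+-comm (+ dq) (+ dp))) (bound q p c≤νq ↥q≢0)) ⟩
  + νℤ (↥ p ℤ.* ↧ q ℤ.+ ↥ q ℤ.* ↧ p)  ∎)
  where
  open ℤₚ.≤-Reasoning
  dp dq : ℕ
  dp = ν (↧ₙ p); dq = ν (↧ₙ q)
  bound : ∀ p q → c ℤ.≤ νᵘ p → ↥ p ≢ 0ℤ → c ℤ.+ (+ ν (↧ₙ p) ℤ.+ + ν (↧ₙ q)) ℤ.≤ + νℤ (↥ p ℤ.* ↧ q)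
  bound p q c≤νp ↥p≢0 = begin
    c ℤ.+ (+ ν (↧ₙ p) ℤ.+ + ν (↧ₙ q))      ≡⟨ ℤₚ.+-assoc c _ _ ⟨
    c ℤ.+ + ν (↧ₙ p) ℤ.+ + ν (↧ₙ q)        ≤⟨ ℤₚ.+-monoˡ-≤ (+ ν (↧ₙ q)) (c≤a-b⇒c+b≤a {a = + νℤ (↥ p)} (+ ν (↧ₙ p)) c≤νp) ⟩
    + νℤ (↥ p) ℤ.+ + ν (↧ₙ q)              ≡⟨ ℤₚ.pos-+ (νℤ (↥ p)) (ν (↧ₙ q)) ⟨
    + (νℤ (↥ p) ℕ.+ ν (↧ₙ q))              ≡⟨ cong +_ (νℤ-* ↥p≢0 (λ ())) ⟨
    + νℤ (↥ p ℤ.* ↧ q)                     ∎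

record Valuation : Set where
  field
    v     : ℚ → ℤ
    v-*   : ∀ {a b} → a ≢ 0ℚ → b ≢ 0ℚ → v (a ℚ.* b) ≡ v a ℤ.+ v b
    v-+   : ∀ {c a b} → a ≢ 0ℚ → b ≢ 0ℚ → a ℚ.+ b ≢ 0ℚ → c ℤ.≤ v a → c ℤ.≤ v b → c ℤ.≤ v (a ℚ.+ b)
    v-neg : ∀ a → v (ℚ.- a) ≡ v a

p*q≢0 : ∀ {p q} → p ≢ 0ℚ → q ≢ 0ℚ → p ℚ.* q ≢ 0ℚ
p*q≢0 {p} {q} p≢0 q≢0 pq≡0 = q≢0 (begin
  q                      ≡⟨ ℚₚ.*-identityˡ q ⟨
  1ℚ ℚ.* q               ≡⟨ cong (ℚ._* q) (ℚₚ.*-inverseˡ p) ⟨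
  (ℚ.1/ p ℚ.* p) ℚ.* q   ≡⟨ ℚₚ.*-assoc (ℚ.1/ p) p q ⟩
  ℚ.1/ p ℚ.* (p ℚ.* q)   ≡⟨ cong (ℚ.1/ p ℚ.*_) pq≡0 ⟩
  ℚ.1/ p ℚ.* 0ℚ          ≡⟨ ℚₚ.*-zeroʳ (ℚ.1/ p) ⟩
  0ℚ                     ∎)
  where
  open ≡-Reasoning
  instance _ = ℚ.≢-nonZero p≢0

↥toℚᵘ≢0 : ∀ {p} → p ≢ 0ℚ → ↥ toℚᵘ p ≢ 0ℤ
↥toℚᵘ≢0 {p@(mkℚ _ _ _)} p≢0 = p≢0 ∘ ℚₚ.↥p≡0⇒p≡0 p

2-adic : Valuation
2-adic = record
  { v     = νᵘ ∘ toℚᵘ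
  ; v-*   = λ {a} {b} a≢0 b≢0 → trans
      (νᵘ-cong (ℚₚ.toℚᵘ-homo-* a b) (↥toℚᵘ≢0 (p*q≢0 a≢0 b≢0)))
      (νᵘ-* {toℚᵘ a} {toℚᵘ b} (↥toℚᵘ≢0 a≢0) (↥toℚᵘ≢0 b≢0))
  ; v-+   = λ {c} {a} {b} a≢0 b≢0 a+b≢0 c≤νa c≤νb → subst (c ℤ.≤_)
      (sym (νᵘ-cong (ℚₚ.toℚᵘ-homo-+ a b) (↥toℚᵘ≢0 a+b≢0)))
      (νᵘ-+ {p = toℚᵘ a} {toℚᵘ b} (↥toℚᵘ≢0 a≢0) (↥toℚᵘ≢0 b≢0)
        (≃-↥≢0 (ℚₚ.toℚᵘ-homo-+ a b) (↥toℚᵘ≢0 a+b≢0)) c≤νa c≤νb)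
  ; v-neg = λ { (mkℚ -[1+ _ ] _ _) → refl ; (mkℚ (+ 0) _ _) → refl ; (mkℚ +[1+ _ ] _ _) → refl }
  }

coeff-+ : ∀ p q k → coeff (p +ₚ q) k ≡ coeff p k ℚ.+ coeff q k
coeff-+ []      q       k       = sym (ℚₚ.+-identityˡ (coeff q k))
coeff-+ (a ∷ p) []      k       = sym (ℚₚ.+-identityʳ (coeff (a ∷ p) k))
coeff-+ (a ∷ p) (b ∷ q) zero    = refl
coeff-+ (a ∷ p) (b ∷ q) (suc k) = coeff-+ p q k

coeff-map : ∀ (f : ℚ → ℚ) → f 0ℚ ≡ 0ℚ → ∀ p k → coeff (map f p) k ≡ f (coeff p k)
coeff-map f f0≡0 []      k       = sym f0≡0
coeff-map f f0≡0 (a ∷ p) zero    = refl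
coeff-map f f0≡0 (a ∷ p) (suc k) = coeff-map f f0≡0 p k

coeff-∷-* : ∀ a p q k → coeff ((a ∷ p) *ₚ q) k ≡ a ℚ.* coeff q k ℚ.+ coeff (0ℚ ∷ p *ₚ q) k
coeff-∷-* a p q k = trans (coeff-+ (map (a ℚ.*_) q) (0ℚ ∷ p *ₚ q) k)
  (cong (ℚ._+ coeff (0ℚ ∷ p *ₚ q) k) (coeff-map (a ℚ.*_) (ℚₚ.*-zeroʳ a) q k))

coeff-*-0 : ∀ g h → coeff (g *ₚ h) 0 ≡ coeff g 0 ℚ.* coeff h 0
coeff-*-0 []      h = sym (ℚₚ.*-zeroˡ (coeff h 0))
coeff-*-0 (a ∷ p) h = trans (coeff-∷-* a p h 0) (ℚₚ.+-identityʳ _)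

coeff-*-C : ∀ g r k → coeff (g *ₚ C r) k ≡ coeff g k ℚ.* r
coeff-*-C []      r k       = sym (ℚₚ.*-zeroˡ r)
coeff-*-C (a ∷ p) r zero    = trans (coeff-∷-* a p (C r) 0) (ℚₚ.+-identityʳ _)
coeff-*-C (a ∷ p) r (suc k) = begin
  coeff ((a ∷ p) *ₚ C r) (suc k)           ≡⟨ coeff-∷-* a p (C r) (suc k) ⟩
  a ℚ.* 0ℚ ℚ.+ coeff (p *ₚ C r) k          ≡⟨ cong₂ ℚ._+_ (ℚₚ.*-zeroʳ a) (coeff-*-C p r k) ⟩
  0ℚ ℚ.+ coeff p k ℚ.* r                   ≡⟨ ℚₚ.+-identityˡ _ ⟩
  coeff p k ℚ.* r                          ∎
  where open ≡-Reasoning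

+-<⇒<⊎< : ∀ {m n i j} → m + n < i + j → m < i ⊎ n < j
+-<⇒<⊎< {m} {n} {i} {j} lt with m ℕₚ.<? i | n ℕₚ.<? j
... | yes m<i | _       = inj₁ m<i
... | no _    | yes n<j = inj₂ n<j
... | no m≮i  | no n≮j  = contradiction lt (ℕₚ.≤⇒≯ (ℕₚ.+-mono-≤ (ℕₚ.≮⇒≥ m≮i) (ℕₚ.≮⇒≥ n≮j)))

+-≡⇒<⊎< : ∀ {m n i j} → i + j ≡ m + n → i ≢ m → m < i ⊎ n < j
+-≡⇒<⊎< {m} {n} {i} {j} e i≢m with ℕₚ.<-cmp i m
... | tri> _ _ m<i = inj₁ m<i
... | tri≈ _ i≡m _ = contradiction i≡m i≢m
... | tri< i<m _ _ with +-<⇒<⊎< (subst (_< m + j) e (ℕₚ.+-monoˡ-< j i<m))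
...   | inj₁ m<m = contradiction m<m (ℕₚ.<-irrefl refl)
...   | inj₂ n<j = inj₂ n<j

p≡p+q-q : ∀ p q → p ≡ p ℚ.+ q ℚ.- q
p≡p+q-q p q = sym (begin
  p ℚ.+ q ℚ.- q          ≡⟨ ℚₚ.+-assoc p q (ℚ.- q) ⟩
  p ℚ.+ (q ℚ.- q)        ≡⟨ cong (p ℚ.+_) (ℚₚ.+-inverseʳ q) ⟩
  p ℚ.+ 0ℚ               ≡⟨ ℚₚ.+-identityʳ p ⟩
  p                      ∎)
  where open ≡-Reasoning

module Weighted (V : Valuation) (A : ℕ) (B : ℤ) where

  open Valuation V

  weight : ℚ → ℕ → ℤ
  weight a k = + A ℤ.* v a ℤ.+ B ℤ.* + k

  -- The monomial a xᵏ has weight at least c; vacuous for a = 0, whose valuation is +∞.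
  AtLeast : ℚ → ℕ → ℤ → Set
  AtLeast a k c = a ≢ 0ℚ → c ℤ.≤ weight a k

  Exactly : ℚ → ℕ → ℤ → Set
  Exactly a k c = a ≢ 0ℚ × weight a k ≡ c

  zero⇒atLeast : ∀ {a k c} → a ≡ 0ℚ → AtLeast a k c
  zero⇒atLeast a≡0 a≢0 = contradiction a≡0 a≢0

  atLeast-weaken : ∀ {a k c d} → c ℤ.≤ d → AtLeast a k d → AtLeast a k c
  atLeast-weaken c≤d a≥d = ℤₚ.≤-trans c≤d ∘ a≥d

  exactly⇒atLeast : ∀ {a k c} → Exactly a k c → AtLeast a k c
  exactly⇒atLeast (_ , w≡c) _ = ℤₚ.≤-reflexive (sym w≡c)

  atLeast-at : ∀ {a i k c} → i ≡ k → AtLeast a i c → AtLeast a k c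
  atLeast-at refl a≥c = a≥c

  weight-mono : ∀ {a b} k → v a ℤ.≤ v b → weight a k ℤ.≤ weight b k
  weight-mono k va≤vb = ℤₚ.+-monoˡ-≤ (B ℤ.* + k) (ℤₚ.*-monoˡ-≤-nonNeg (+ A) va≤vb)

  weight-neg : ∀ a k → weight (ℚ.- a) k ≡ weight a k
  weight-neg a k = cong (λ x → + A ℤ.* x ℤ.+ B ℤ.* + k) (v-neg a)

  weight-* : ∀ {a b} i j → a ≢ 0ℚ → b ≢ 0ℚ → weight (a ℚ.* b) (i + j) ≡ weight a i ℤ.+ weight b j
  weight-* {a} {b} i j a≢0 b≢0 = begin
    + A ℤ.* v (a ℚ.* b) ℤ.+ B ℤ.* + (i + j)        ≡⟨ cong₂ (λ x y → + A ℤ.* x ℤ.+ B ℤ.* y) (v-* a≢0 b≢0) (ℤₚ.pos-+ i j) ⟩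
    + A ℤ.* (v a ℤ.+ v b) ℤ.+ B ℤ.* (+ i ℤ.+ + j)  ≡⟨ distribute (+ A) (v a) (v b) B (+ i) (+ j) ⟩
    weight a i ℤ.+ weight b j                      ∎
    where
    open ≡-Reasoning
    distribute : ∀ α x y β i j → α ℤ.* (x ℤ.+ y) ℤ.+ β ℤ.* (i ℤ.+ j) ≡ (α ℤ.* x ℤ.+ β ℤ.* i) ℤ.+ (α ℤ.* y ℤ.+ β ℤ.* j)
    distribute = solve-∀

  weight-suc : ∀ a k → weight a (suc k) ≡ weight a k ℤ.+ B
  weight-suc a k = distribute (+ A) (v a) B (+ k)
    where
    distribute : ∀ α x β k → α ℤ.* x ℤ.+ β ℤ.* (1ℤ ℤ.+ k) ≡ α ℤ.* x ℤ.+ β ℤ.* k ℤ.+ β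
    distribute = solve-∀

  atLeast-neg : ∀ {a k c} → AtLeast a k c → AtLeast (ℚ.- a) k c
  atLeast-neg {a} {k} a≥c -a≢0 = subst (_ ℤ.≤_) (sym (weight-neg a k)) (a≥c (λ a≡0 → -a≢0 (cong (λ x → ℚ.- x) a≡0)))

  atLeast-+ : ∀ {a b k c} → AtLeast a k c → AtLeast b k c → AtLeast (a ℚ.+ b) k c
  atLeast-+ {a} {b} {k} a≥c b≥c a+b≢0 with a ℚₚ.≟ 0ℚ | b ℚₚ.≟ 0ℚ
  ... | yes refl | _        = subst (λ x → _ ℤ.≤ weight x k) (sym (ℚₚ.+-identityˡ b)) (b≥c (a+b≢0 ∘ trans (ℚₚ.+-identityˡ b)))
  ... | no _     | yes refl = subst (λ x → _ ℤ.≤ weight x k) (sym (ℚₚ.+-identityʳ a)) (a≥c (a+b≢0 ∘ trans (ℚₚ.+-identityʳ a)))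
  ... | no a≢0   | no b≢0 with ℤₚ.≤-total (v a) (v b)
  ...   | inj₁ va≤vb = ℤₚ.≤-trans (a≥c a≢0) (weight-mono k (v-+ a≢0 b≢0 a+b≢0 ℤₚ.≤-refl va≤vb))
  ...   | inj₂ vb≤va = ℤₚ.≤-trans (b≥c b≢0) (weight-mono k (v-+ a≢0 b≢0 a+b≢0 vb≤va ℤₚ.≤-refl))

  atLeast-* : ∀ {a b i j c d} → AtLeast a i c → AtLeast b j d → AtLeast (a ℚ.* b) (i + j) (c ℤ.+ d)
  atLeast-* {a} {b} {i} {j} a≥c b≥d ab≢0 = subst (_ ℤ.≤_) (sym (weight-* i j a≢0 b≢0)) (ℤₚ.+-mono-≤ (a≥c a≢0) (b≥d b≢0))
    where
    a≢0 : a ≢ 0ℚ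
    a≢0 = λ a≡0 → ab≢0 (trans (cong (ℚ._* b) a≡0) (ℚₚ.*-zeroˡ b))
    b≢0 : b ≢ 0ℚ
    b≢0 = λ b≡0 → ab≢0 (trans (cong (a ℚ.*_) b≡0) (ℚₚ.*-zeroʳ a))

  exactly-* : ∀ {a b i j c d} → Exactly a i c → Exactly b j d → Exactly (a ℚ.* b) (i + j) (c ℤ.+ d)
  exactly-* {i = i} {j} (a≢0 , wa≡c) (b≢0 , wb≡d) = p*q≢0 a≢0 b≢0 , trans (weight-* i j a≢0 b≢0) (cong₂ ℤ._+_ wa≡c wb≡d)

  -- If a + b had weight above c, so would a = (a + b) − b.
  exactly-+ : ∀ {a b k c} → Exactly a k c → AtLeast b k (ℤ.suc c) → Exactly (a ℚ.+ b) k c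
  exactly-+ {a} {b} {k} {c} a=c@(a≢0 , wa≡c) b>c = a+b≢0 , ℤₚ.≤-antisym upper lower
    where
    suc≰ : ∀ {x} → ℤ.suc c ℤ.≤ x → x ℤ.≤ c → ⊥
    suc≰ sc≤x x≤c = ℤₚ.<-irrefl refl (ℤₚ.suc[i]≤j⇒i<j (ℤₚ.≤-trans sc≤x x≤c))
    a+b≢0 : a ℚ.+ b ≢ 0ℚ
    a+b≢0 a+b≡0 = suc≰ (b>c b≢0) (ℤₚ.≤-reflexive (trans (cong (λ x → weight x k) b≡-a) (trans (weight-neg a k) wa≡c)))
      where
      b≡-a : b ≡ ℚ.- a
      b≡-a = inverseʳ-unique a b a+b≡0
      b≢0 : b ≢ 0ℚ
      b≢0 = λ b≡0 → a≢0 (ℚₚ.neg-injective (trans (sym b≡-a) b≡0))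
    lower : c ℤ.≤ weight (a ℚ.+ b) k
    lower = atLeast-+ (exactly⇒atLeast a=c) (atLeast-weaken (ℤₚ.i≤suc[i] c) b>c) a+b≢0
    upper : weight (a ℚ.+ b) k ℤ.≤ c
    upper with weight (a ℚ.+ b) k ℤₚ.≤? c
    ... | yes w≤c = w≤c
    ... | no  w≰c = contradiction (ℤₚ.≤-reflexive wa≡c) (suc≰ (subst (λ x → AtLeast x k (ℤ.suc c)) (sym (p≡p+q-q a b))
                      (atLeast-+ (λ _ → ℤₚ.i<j⇒suc[i]≤j (ℤₚ.≰⇒> w≰c)) (atLeast-neg b>c)) a≢0))

  Bounded : Poly → ℤ → Set
  Bounded g c = ∀ k → AtLeast (coeff g k) k c

  coeff-*-atLeast : ∀ g h k {m c} → (∀ i j → i + j ≡ k → AtLeast (coeff g i ℚ.* coeff h j) m c) →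
                    AtLeast (coeff (g *ₚ h) k) m c
  coeff-*-atLeast []      h k       pairs = zero⇒atLeast refl
  coeff-*-atLeast (a ∷ p) h zero    pairs = subst (λ x → AtLeast x _ _) (sym (coeff-∷-* a p h 0))
    (atLeast-+ (pairs 0 0 refl) (zero⇒atLeast refl))
  coeff-*-atLeast (a ∷ p) h (suc k) pairs = subst (λ x → AtLeast x _ _) (sym (coeff-∷-* a p h (suc k)))
    (atLeast-+ (pairs 0 (suc k) refl) (coeff-*-atLeast p h k λ i j e → pairs (suc i) j (cong suc e)))

  coeff-*-exactly : ∀ g h {m c} i₀ j₀ → Exactly (coeff g i₀ ℚ.* coeff h j₀) m c →
                    (∀ i j → i + j ≡ i₀ + j₀ → i ≢ i₀ → AtLeast (coeff g i ℚ.* coeff h j) m (ℤ.suc c)) →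
                    Exactly (coeff (g *ₚ h) (i₀ + j₀)) m c
  coeff-*-exactly []      h i₀ j₀ (0≢0 , _) others = contradiction (ℚₚ.*-zeroˡ (coeff h j₀)) 0≢0
  coeff-*-exactly (a ∷ p) h zero zero exact others = subst (λ x → Exactly x _ _) (sym (coeff-∷-* a p h 0))
    (exactly-+ exact (zero⇒atLeast refl))
  coeff-*-exactly (a ∷ p) h zero (suc k) exact others = subst (λ x → Exactly x _ _) (sym (coeff-∷-* a p h (suc k)))
    (exactly-+ exact (coeff-*-atLeast p h k λ i j e → others (suc i) j (cong suc e) λ ()))
  coeff-*-exactly (a ∷ p) h (suc i₀) j₀ exact others =
    subst (λ x → Exactly x _ _) (sym (trans (coeff-∷-* a p h (suc (i₀ + j₀))) (ℚₚ.+-comm (a ℚ.* coeff h (suc (i₀ + j₀))) _)))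
      (exactly-+ (coeff-*-exactly p h i₀ j₀ exact λ i j e i≢i₀ → others (suc i) j (cong suc e) (i≢i₀ ∘ ℕₚ.suc-injective))
                 (others 0 (suc (i₀ + j₀)) refl λ ()))

  record Highest (g : Poly) : Set where
    field
      minimum : ℤ
      index   : ℕ
      exact   : Exactly (coeff g index) index minimum
      bound   : Bounded g minimum
      beyond  : ∀ k → index < k → AtLeast (coeff g k) k (ℤ.suc minimum)

  open Highest public

  highest-* : ∀ {g h} → Highest g → Highest h → Highest (g *ₚ h)
  highest-* {g} {h} G H = record
    { minimum = cg ℤ.+ ch
    ; index   = ig + ih
    ; exact   = coeff-*-exactly g h ig ih (exactly-* (exact G) (exact H))
                  λ i j e i≢ig → atLeast-at e (pair-beyond i j (+-≡⇒<⊎< e i≢ig))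
    ; bound   = λ k → coeff-*-atLeast g h k λ i j e → atLeast-at e (atLeast-* (bound G i) (bound H j))
    ; beyond  = λ k ig+ih<k → coeff-*-atLeast g h k λ i j e →
                  atLeast-at e (pair-beyond i j (+-<⇒<⊎< (subst (ig + ih <_) (sym e) ig+ih<k)))
    }
    where
    cg ch : ℤ
    cg = minimum G; ch = minimum H
    ig ih : ℕ
    ig = index G; ih = index H
    suc-on-right : ∀ x y → 1ℤ ℤ.+ (x ℤ.+ y) ≡ x ℤ.+ (1ℤ ℤ.+ y)
    suc-on-right = solve-∀
    pair-beyond : ∀ i j → ig < i ⊎ ih < j → AtLeast (coeff g i ℚ.* coeff h j) (i + j) (ℤ.suc (cg ℤ.+ ch))
    pair-beyond i j (inj₁ ig<i) = atLeast-weaken (ℤₚ.≤-reflexive (sym (ℤₚ.+-assoc 1ℤ cg ch)))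
                                    (atLeast-* (beyond G i ig<i) (bound H j))
    pair-beyond i j (inj₂ ih<j) = atLeast-weaken (ℤₚ.≤-reflexive (suc-on-right cg ch))
                                    (atLeast-* (bound G i) (beyond H j ih<j))

  atLeast-suc : ∀ {a k c} → AtLeast a k c → AtLeast a (suc k) (c ℤ.+ B)
  atLeast-suc {a} {k} a≥c a≢0 = subst (_ ℤ.≤_) (sym (weight-suc a k)) (ℤₚ.+-monoˡ-≤ B (a≥c a≢0))

  shift : ∀ {a p} (P : Highest p) → AtLeast a 0 (minimum P ℤ.+ B) → Highest (a ∷ p)
  shift {a} {p} P a≥ = record
    { minimum = minimum P ℤ.+ B
    ; index   = suc (index P)
    ; exact   = proj₁ (exact P) , trans (weight-suc _ (index P)) (cong (ℤ._+ B) (proj₂ (exact P)))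
    ; bound   = λ { zero → a≥ ; (suc k) → atLeast-suc (bound P k) }
    ; beyond  = λ { (suc k) (s≤s i<k) → atLeast-weaken (ℤₚ.≤-reflexive (sym (ℤₚ.+-assoc 1ℤ (minimum P) B)))
                                           (atLeast-suc (beyond P k i<k)) }
    }

  extend : ∀ a {p} → Highest p → Highest (a ∷ p)
  extend a P with a ℚₚ.≟ 0ℚ
  ... | yes a≡0 = shift P (zero⇒atLeast a≡0)
  ... | no a≢0 with minimum P ℤ.+ B ℤₚ.≤? weight a 0
  ...   | yes above = shift P λ _ → above
  ...   | no below = record
    { minimum = weight a 0
    ; index   = 0
    ; exact   = a≢0 , refl
    ; bound   = λ { zero _ → ℤₚ.≤-refl ; (suc k) → atLeast-weaken (ℤₚ.<⇒≤ (ℤₚ.≰⇒> below)) (atLeast-suc (bound P k)) }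
    ; beyond  = λ { (suc k) _ → atLeast-weaken (ℤₚ.i<j⇒suc[i]≤j (ℤₚ.≰⇒> below)) (atLeast-suc (bound P k)) }
    }

  constant : ∀ {a p} → a ≢ 0ℚ → p ≈ₚ [] → Highest (a ∷ p)
  constant {a} a≢0 p≈0 = record
    { minimum = weight a 0
    ; index   = 0
    ; exact   = a≢0 , refl
    ; bound   = λ { zero _ → ℤₚ.≤-refl ; (suc k) → zero⇒atLeast (p≈0 k) }
    ; beyond  = λ { (suc k) _ → zero⇒atLeast (p≈0 k) }
    }

  highest : ∀ g → g ≈ₚ [] ⊎ Highest g
  highest []      = inj₁ λ _ → refl
  highest (a ∷ p) with highest p | a ℚₚ.≟ 0ℚ
  ... | inj₂ P   | _        = inj₂ (extend a P)
  ... | inj₁ p≈0 | yes a≡0  = inj₁ λ { zero → a≡0 ; (suc k) → p≈0 k }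
  ... | inj₁ p≈0 | no a≢0   = inj₂ (constant a≢0 p≈0)

  highest-≉0 : ∀ g → ¬ g ≈ₚ [] → Highest g
  highest-≉0 g g≉0 with highest g
  ... | inj₁ g≈0 = contradiction g≈0 g≉0
  ... | inj₂ G   = G

record Degree (g : Poly) (d : ℕ) : Set where
  constructor degree-is
  field
    leading≢0 : coeff g d ≢ 0ℚ
    vanish    : ∀ k → d < k → coeff g k ≡ 0ℚ

trivial : Valuation
trivial = record
  { v     = λ _ → 0ℤ
  ; v-*   = λ _ _ → refl
  ; v-+   = λ _ _ _ c≤0 _ → c≤0
  ; v-neg = λ _ → refl
  }

-- For the trivial valuation and weight −k, the highest index of minimal weight is the degree.
module ByDegree = Weighted trivial 0 -1ℤ

weight-trivial : ∀ a k → ByDegree.weight a k ≡ ℤ.- (+ k)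
weight-trivial a k = simplify (+ k)
  where
  simplify : ∀ k → 0ℤ ℤ.* 0ℤ ℤ.+ -1ℤ ℤ.* k ≡ ℤ.- k
  simplify = solve-∀

highest⇒degree : ∀ {g} (G : ByDegree.Highest g) → Degree g (ByDegree.index G)
highest⇒degree {g} G = degree-is (proj₁ (ByDegree.exact G)) vanish
  where
  i : ℕ
  i = ByDegree.index G
  vanish : ∀ k → i < k → coeff g k ≡ 0ℚ
  vanish k i<k with coeff g k ℚₚ.≟ 0ℚ
  ... | yes gₖ≡0 = gₖ≡0
  ... | no  gₖ≢0 = contradiction i<k (ℕₚ.<-asym (ℤₚ.drop‿+<+ (ℤₚ.neg-cancel-< (ℤₚ.suc[i]≤j⇒i<j (begin
    ℤ.suc (ℤ.- (+ i))              ≡⟨ cong ℤ.suc (trans (sym (weight-trivial (coeff g i) i)) (proj₂ (ByDegree.exact G))) ⟩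
    ℤ.suc (ByDegree.minimum G)     ≤⟨ ByDegree.beyond G k i<k gₖ≢0 ⟩
    ByDegree.weight (coeff g k) k  ≡⟨ weight-trivial (coeff g k) k ⟩
    ℤ.- (+ k)                      ∎)))))
    where open ℤₚ.≤-Reasoning

degree⇒highest : ∀ {g d} → Degree g d → ByDegree.Highest g
degree⇒highest {g} {d} (degree-is gd≢0 vanish) = record
  { minimum = ℤ.- (+ d)
  ; index   = d
  ; exact   = gd≢0 , weight-trivial (coeff g d) d
  ; bound   = bounded
  ; beyond  = λ k d<k → ByDegree.zero⇒atLeast {k = k} (vanish k d<k)
  }
  where
  bounded : ∀ k → ByDegree.AtLeast (coeff g k) k (ℤ.- (+ d))
  bounded k with k ℕₚ.≤? d
  ... | yes k≤d = λ _ → ℤₚ.≤-trans (ℤₚ.neg-mono-≤ (+≤+ k≤d)) (ℤₚ.≤-reflexive (sym (weight-trivial (coeff g k) k)))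
  ... | no  k≰d = ByDegree.zero⇒atLeast {k = k} (vanish k (ℕₚ.≰⇒> k≰d))

degree : ∀ g → ¬ g ≈ₚ [] → ∃[ d ] Degree g d
degree g g≉0 = ByDegree.index G , highest⇒degree G
  where
  G : ByDegree.Highest g
  G = ByDegree.highest-≉0 g g≉0

degree-* : ∀ {g h d e} → Degree g d → Degree h e → Degree (g *ₚ h) (d + e)
degree-* Dg Dh = highest⇒degree (ByDegree.highest-* (degree⇒highest Dg) (degree⇒highest Dh))

degree-cong : ∀ {g h d} → g ≈ₚ h → Degree g d → Degree h d
degree-cong g≈h (degree-is gd≢0 vanish) = degree-is (gd≢0 ∘ trans (g≈h _)) λ k d<k → trans (sym (g≈h k)) (vanish k d<k)

≤-degree : ∀ {g d k} → Degree g d → coeff g k ≢ 0ℚ → k ≤ d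
≤-degree {k = k} (degree-is _ vanish) gₖ≢0 with k ℕₚ.≤? _
... | yes k≤d = k≤d
... | no  k≰d = contradiction (vanish k (ℕₚ.≰⇒> k≰d)) gₖ≢0

degree-unique : ∀ {g d e} → Degree g d → Degree g e → d ≡ e
degree-unique Dd De = ℕₚ.≤-antisym (≤-degree De (Degree.leading≢0 Dd)) (≤-degree Dd (Degree.leading≢0 De))

degree-0⇒unit : ∀ {g} → Degree g 0 → IsUnit g
degree-0⇒unit {g} (degree-is g₀≢0 vanish) = C (ℚ.1/ coeff g 0) , λ k → trans (coeff-*-C g _ k) (inverse k)
  where
  instance _ = ℚ.≢-nonZero g₀≢0
  inverse : ∀ k → coeff g k ℚ.* ℚ.1/ coeff g 0 ≡ coeff (C 1ℚ) k
  inverse zero    = ℚₚ.*-inverseʳ (coeff g 0)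
  inverse (suc k) = trans (cong (ℚ._* _) (vanish (suc k) (s≤s z≤n))) (ℚₚ.*-zeroˡ (ℚ.1/ coeff g 0))

positive-degree⇒¬unit : ∀ {g d} → Degree g d → 0 < d → ¬ IsUnit g
positive-degree⇒¬unit {g} {d} Dg 0<d (q , gq≈1) =
  let e , Dq = degree q q≉0 in
  ℕₚ.<⇒≢ (ℕₚ.<-≤-trans 0<d (ℕₚ.m≤m+n d e)) (sym (degree-unique (degree-cong gq≈1 (degree-* Dg Dq)) degree-1))
  where
  q≉0 : ¬ q ≈ₚ []
  q≉0 q≈0 = ℚₚ.1≢0 (trans (sym (gq≈1 0)) (trans (coeff-*-0 g q) (trans (cong (coeff g 0 ℚ.*_) (q≈0 0)) (ℚₚ.*-zeroʳ (coeff g 0)))))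
  degree-1 : Degree (C 1ℚ) 0
  degree-1 = degree-is (λ ()) λ { (suc k) _ → refl }

cofactor-degree-0 : ∀ {m n N} → m + n ≡ N → N ≤ n → m ≡ 0
cofactor-degree-0 {m} {n} m+n≡N N≤n = ℕₚ.n≤0⇒n≡0 (ℕₚ.+-cancelʳ-≤ n m 0 (subst (_≤ n) (sym m+n≡N) N≤n))

multiple-of-N : ∀ {N i} → 1 ≤ N → i ≤ N → N ∣ i → i ≡ 0 ⊎ i ≡ N
multiple-of-N {N} {zero}  _ _   _   = inj₁ refl
multiple-of-N {N} {suc i} _ i≤N N∣i = inj₂ (ℕₚ.≤-antisym i≤N (∣⇒≤ N∣i))

[1+N]*k<N*n : ∀ {N k n} → k < N → N ≤ n → suc N * k < N * n
[1+N]*k<N*n {suc M} {k} {n} (s≤s k≤M) N≤n = begin-strict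
  suc (suc M) * k         ≤⟨ ℕₚ.*-monoʳ-≤ (suc (suc M)) k≤M ⟩
  suc (suc M) * M         <⟨ ℕₚ.n<1+n _ ⟩
  suc (suc (suc M) * M)   ≡⟨ square M ⟩
  suc M * suc M           ≤⟨ ℕₚ.*-monoʳ-≤ (suc M) N≤n ⟩
  suc M * n               ∎
  where
  open ℕₚ.≤-Reasoning
  square : ∀ M → suc (suc (suc M) * M) ≡ suc M * suc M
  square = ℕ-solve-∀

-- Dumas' criterion for a Newton polygon that is the single segment from (0, v f₀) to (N, v f₀ + N + 1):
-- the weight N v(a) − (N + 1) k is minimal exactly at k = 0 and k = N.
module Dumas (V : Valuation) (N : ℕ) where

  open Valuation V
  open Weighted V N -[1+ N ]

  record DumasCondition (f : Poly) : Set where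
    field
      constant≢0 : coeff f 0 ≢ 0ℚ
      top        : Exactly (coeff f N) N (weight (coeff f 0) 0)
      middle     : ∀ k → 0 < k → k < N → AtLeast (coeff f k) k (ℤ.suc (weight (coeff f 0) 0))
      vanish     : ∀ k → N < k → coeff f k ≡ 0ℚ
      positive   : 1 ≤ N

  -- Equal weights at 0 and i give N (v b − v a) = (N + 1) i, so N ∣ i as N and N + 1 are coprime.
  equal-weights⇒endpoint : ∀ {a b i} → 1 ≤ N → i ≤ N → weight a 0 ≡ weight b i → i ≡ 0 ⊎ i ≡ N
  equal-weights⇒endpoint {a} {b} {i} 1≤N i≤N e = multiple-of-N 1≤N i≤N
    (divides ℤ.∣ t ∣ (trans (cong ℤ.∣_∣ i≡N*t) (trans (ℤₚ.abs-* (+ N) t) (ℕₚ.*-comm N ℤ.∣ t ∣))))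
    where
    t : ℤ
    t = v b ℤ.- v a ℤ.- + i
    identity : ∀ n a b i →
      i ≡ n ℤ.* (b ℤ.- a ℤ.- i) ℤ.- ((n ℤ.* b ℤ.+ ℤ.- (1ℤ ℤ.+ n) ℤ.* i) ℤ.- (n ℤ.* a ℤ.+ ℤ.- (1ℤ ℤ.+ n) ℤ.* 0ℤ))
    identity = solve-∀
    i≡N*t : + i ≡ + N ℤ.* t
    i≡N*t = begin
      + i                                                  ≡⟨ identity (+ N) (v a) (v b) (+ i) ⟩
      + N ℤ.* t ℤ.- (weight b i ℤ.- weight a 0)            ≡⟨ cong (λ x → + N ℤ.* t ℤ.- (weight b i ℤ.- x)) e ⟩
      + N ℤ.* t ℤ.- (weight b i ℤ.- weight b i)            ≡⟨ cong (λ x → + N ℤ.* t ℤ.- x) (ℤₚ.+-inverseʳ (weight b i)) ⟩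
      + N ℤ.* t ℤ.- 0ℤ                                     ≡⟨ ℤₚ.+-identityʳ _ ⟩
      + N ℤ.* t                                            ∎
      where open ≡-Reasoning

  module _ {f} (D : DumasCondition f) where

    open DumasCondition D

    c₀ : ℤ
    c₀ = weight (coeff f 0) 0

    bounded : Bounded f c₀
    bounded zero    = exactly⇒atLeast (constant≢0 , refl)
    bounded (suc k) with ℕₚ.<-cmp (suc k) N
    ... | tri< k<N _ _  = atLeast-weaken (ℤₚ.i≤suc[i] c₀) (middle (suc k) (s≤s z≤n) k<N)
    ... | tri≈ _ k≡N _ = subst (λ i → AtLeast (coeff f i) i c₀) (sym k≡N) (exactly⇒atLeast top)
    ... | tri> _ _ N<k  = zero⇒atLeast (vanish (suc k) N<k)

    degree-f : Degree f N
    degree-f = degree-is (proj₁ top) vanish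

    module Factorisation {g h} (f≈gh : f ≈ₚ g *ₚ h) where

      f₀≡g₀h₀ : coeff f 0 ≡ coeff g 0 ℚ.* coeff h 0
      f₀≡g₀h₀ = trans (f≈gh 0) (coeff-*-0 g h)

      g₀≢0 : coeff g 0 ≢ 0ℚ
      g₀≢0 g₀≡0 = constant≢0 (trans f₀≡g₀h₀ (trans (cong (ℚ._* coeff h 0) g₀≡0) (ℚₚ.*-zeroˡ (coeff h 0))))

      h₀≢0 : coeff h 0 ≢ 0ℚ
      h₀≢0 h₀≡0 = constant≢0 (trans f₀≡g₀h₀ (trans (cong (coeff g 0 ℚ.*_) h₀≡0) (ℚₚ.*-zeroʳ (coeff g 0))))

      G : Highest g
      G = highest-≉0 g (g₀≢0 ∘ (_$ 0))
      H : Highest h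
      H = highest-≉0 h (h₀≢0 ∘ (_$ 0))
      GH : Highest (g *ₚ h)
      GH = highest-* G H

      c₀≤minima : c₀ ℤ.≤ minimum G ℤ.+ minimum H
      c₀≤minima = ℤₚ.≤-trans (bounded i f≢0) (ℤₚ.≤-reflexive (trans (cong (λ x → weight x i) (f≈gh i)) (proj₂ (exact GH))))
        where
        i : ℕ
        i = index GH
        f≢0 : coeff f i ≢ 0ℚ
        f≢0 = proj₁ (exact GH) ∘ trans (sym (f≈gh i))

      -- c₀ = weight g₀ + weight h₀ ≥ minimum G + minimum H ≥ c₀, so both summands are minimal.
      g₀-minimal : weight (coeff g 0) 0 ≡ minimum G
      g₀-minimal = ℤₚ.≤-antisym
        (ℤₚ.≮⇒≥ λ mG<wg₀ → ℤₚ.<⇒≱ (ℤₚ.+-mono-<-≤ mG<wg₀ (bound H 0 h₀≢0)) (subst (ℤ._≤ minimum G ℤ.+ minimum H) c₀-split c₀≤minima))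
        (bound G 0 g₀≢0)
        where
        c₀-split : c₀ ≡ weight (coeff g 0) 0 ℤ.+ weight (coeff h 0) 0
        c₀-split = trans (cong (λ x → weight x 0) f₀≡g₀h₀) (weight-* 0 0 g₀≢0 h₀≢0)

      index-sum : index G + index H ≡ N
      index-sum with ℕₚ.<-cmp (index G + index H) N
      ... | tri≈ _ e _   = e
      ... | tri> _ _ N<i = contradiction (trans (sym (f≈gh _)) (vanish _ N<i)) (proj₁ (exact GH))
      ... | tri< i<N _ _ = contradiction (ℤₚ.suc[i]≤j⇒i<j (begin
        ℤ.suc (minimum G ℤ.+ minimum H)   ≤⟨ beyond GH N i<N (proj₁ top ∘ trans (f≈gh N)) ⟩
        weight (coeff (g *ₚ h) N) N       ≡⟨ cong (λ x → weight x N) (f≈gh N) ⟨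
        weight (coeff f N) N              ≡⟨ proj₂ top ⟩
        c₀                                ≤⟨ c₀≤minima ⟩
        minimum G ℤ.+ minimum H           ∎)) (ℤₚ.<-irrefl refl)
        where open ℤₚ.≤-Reasoning

      endpoint : index G ≡ 0 ⊎ index G ≡ N
      endpoint = equal-weights⇒endpoint positive (subst (index G ≤_) index-sum (ℕₚ.m≤m+n _ _))
                   (trans g₀-minimal (sym (proj₂ (exact G))))

      dg : ℕ
      dg = proj₁ (degree g (g₀≢0 ∘ (_$ 0)))
      Dg : Degree g dg
      Dg = proj₂ (degree g (g₀≢0 ∘ (_$ 0)))
      dh : ℕ
      dh = proj₁ (degree h (h₀≢0 ∘ (_$ 0)))
      Dh : Degree h dh
      Dh = proj₂ (degree h (h₀≢0 ∘ (_$ 0)))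

      degree-sum : dg + dh ≡ N
      degree-sum = degree-unique {f} (degree-cong {g *ₚ h} {f} (sym ∘ f≈gh) (degree-* Dg Dh)) degree-f

      g-unit : index G ≡ 0 → IsUnit g
      g-unit iG≡0 = degree-0⇒unit (subst (Degree g) (cofactor-degree-0 degree-sum N≤dh) Dg)
        where
        iH≡N : index H ≡ N
        iH≡N = trans (cong (_+ index H) (sym iG≡0)) index-sum
        N≤dh : N ≤ dh
        N≤dh = ≤-degree {h} {dh} {N} Dh (subst (λ i → coeff h i ≢ 0ℚ) iH≡N (proj₁ (exact H)))

      h-unit : index G ≡ N → IsUnit h
      h-unit iG≡N = degree-0⇒unit (subst (Degree h) (cofactor-degree-0 (trans (ℕₚ.+-comm dh dg) degree-sum) N≤dg) Dh)
        where
        N≤dg : N ≤ dg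
        N≤dg = ≤-degree {g} {dg} {N} Dg (subst (λ i → coeff g i ≢ 0ℚ) iG≡N (proj₁ (exact G)))

      unit : IsUnit g ⊎ IsUnit h
      unit = Sum.map g-unit h-unit endpoint

    dumas-irreducible : Irreducible f
    dumas-irreducible = (constant≢0 ∘ (_$ 0))
                      , positive-degree⇒¬unit {f} degree-f positive
                      , λ g h f≈gh → Factorisation.unit {g} {h} f≈gh

  dumasCondition : ∀ f {n} → 1 ≤ N → N ≤ n →
    coeff f 0 ≢ 0ℚ → v (coeff f 0) ≡ ℤ.- (+ n) →
    (∀ k → 0 < k → coeff f k ≢ 0ℚ → 0ℤ ℤ.≤ v (coeff f k)) →
    coeff f N ≢ 0ℚ → v (coeff f N) ℤ.+ + n ≡ + suc N →
    (∀ k → N < k → coeff f k ≡ 0ℚ) →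
    DumasCondition f
  dumasCondition f {n} 1≤N N≤n f₀≢0 v₀ integral fN≢0 vN vanish = record
    { constant≢0 = f₀≢0
    ; top        = fN≢0 , top-weight
    ; middle     = middle
    ; vanish     = vanish
    ; positive   = 1≤N
    }
    where
    cancel : ∀ x n → x ≡ x ℤ.+ n ℤ.- n
    cancel = solve-∀
    vN′ : v (coeff f N) ≡ + suc N ℤ.- + n
    vN′ = trans (cancel (v (coeff f N)) (+ n)) (cong (ℤ._- + n) vN)
    top-identity : ∀ N n → N ℤ.* ((1ℤ ℤ.+ N) ℤ.- n) ℤ.+ ℤ.- (1ℤ ℤ.+ N) ℤ.* N ≡ N ℤ.* ℤ.- n ℤ.+ ℤ.- (1ℤ ℤ.+ N) ℤ.* 0ℤ
    top-identity = solve-∀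
    top-weight : weight (coeff f N) N ≡ weight (coeff f 0) 0
    top-weight = begin
      + N ℤ.* v (coeff f N) ℤ.+ -[1+ N ] ℤ.* + N      ≡⟨ cong (λ x → + N ℤ.* x ℤ.+ -[1+ N ] ℤ.* + N) vN′ ⟩
      + N ℤ.* (+ suc N ℤ.- + n) ℤ.+ -[1+ N ] ℤ.* + N  ≡⟨ top-identity (+ N) (+ n) ⟩
      + N ℤ.* ℤ.- (+ n) ℤ.+ -[1+ N ] ℤ.* + 0          ≡⟨ cong (λ x → + N ℤ.* x ℤ.+ -[1+ N ] ℤ.* + 0) v₀ ⟨
      weight (coeff f 0) 0                           ∎
      where open ≡-Reasoning
    constant-identity : ∀ N n → N ℤ.* ℤ.- n ℤ.+ ℤ.- (1ℤ ℤ.+ N) ℤ.* 0ℤ ≡ ℤ.- (N ℤ.* n)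
    constant-identity = solve-∀
    weight₀ : weight (coeff f 0) 0 ≡ ℤ.- (+ (N * n))
    weight₀ = begin
      + N ℤ.* v (coeff f 0) ℤ.+ -[1+ N ] ℤ.* + 0    ≡⟨ cong (λ x → + N ℤ.* x ℤ.+ -[1+ N ] ℤ.* + 0) v₀ ⟩
      + N ℤ.* ℤ.- (+ n) ℤ.+ -[1+ N ] ℤ.* + 0        ≡⟨ constant-identity (+ N) (+ n) ⟩
      ℤ.- (+ N ℤ.* + n)                             ≡⟨ cong ℤ.-_ (ℤₚ.pos-* N n) ⟨
      ℤ.- (+ (N * n))                               ∎
      where open ≡-Reasoning
    middle : ∀ k → 0 < k → k < N → AtLeast (coeff f k) k (ℤ.suc (weight (coeff f 0) 0))
    middle k 0<k k<N fk≢0 = begin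
      ℤ.suc (weight (coeff f 0) 0)                  ≡⟨ cong ℤ.suc weight₀ ⟩
      ℤ.suc (ℤ.- (+ (N * n)))                       ≤⟨ ℤₚ.i<j⇒suc[i]≤j (ℤₚ.neg-mono-< (ℤ.+<+ ([1+N]*k<N*n k<N N≤n))) ⟩
      ℤ.- (+ (suc N * k))                           ≡⟨ trans (cong ℤ.-_ (ℤₚ.pos-* (suc N) k)) (ℤₚ.neg-distribˡ-* (+ suc N) (+ k)) ⟩
      -[1+ N ] ℤ.* + k                              ≡⟨ ℤₚ.+-identityˡ _ ⟨
      0ℤ ℤ.+ -[1+ N ] ℤ.* + k                       ≡⟨ cong (ℤ._+ -[1+ N ] ℤ.* + k) (ℤₚ.*-zeroʳ (+ N)) ⟨
      + N ℤ.* 0ℤ ℤ.+ -[1+ N ] ℤ.* + k               ≤⟨ ℤₚ.+-monoˡ-≤ (-[1+ N ] ℤ.* + k) (ℤₚ.*-monoˡ-≤-nonNeg (+ N) (integral k 0<k fk≢0)) ⟩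
      + N ℤ.* v (coeff f k) ℤ.+ -[1+ N ] ℤ.* + k    ∎
      where open ℤₚ.≤-Reasoning

coeff-0∷[] : ∀ k → coeff (0ℚ ∷ []) k ≡ 0ℚ
coeff-0∷[] zero    = refl
coeff-0∷[] (suc k) = refl

-1*p≡-p : ∀ p → ℚ.- 1ℚ ℚ.* p ≡ ℚ.- p
-1*p≡-p p = trans (sym (ℚₚ.neg-distribˡ-* 1ℚ p)) (cong ℚ.-_ (ℚₚ.*-identityˡ p))

coeff-X-*-0 : ∀ p → coeff (X *ₚ p) 0 ≡ 0ℚ
coeff-X-*-0 p = trans (coeff-∷-* 0ℚ (1ℚ ∷ []) p 0) (trans (ℚₚ.+-identityʳ _) (ℚₚ.*-zeroˡ (coeff p 0)))

coeff-X-*-suc : ∀ p k → coeff (X *ₚ p) (suc k) ≡ coeff p k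
coeff-X-*-suc p k = begin
  coeff (X *ₚ p) (suc k)                                     ≡⟨ coeff-∷-* 0ℚ (1ℚ ∷ []) p (suc k) ⟩
  0ℚ ℚ.* coeff p (suc k) ℚ.+ coeff ((1ℚ ∷ []) *ₚ p) k        ≡⟨ cong₂ ℚ._+_ (ℚₚ.*-zeroˡ (coeff p (suc k))) (coeff-∷-* 1ℚ [] p k) ⟩
  0ℚ ℚ.+ (1ℚ ℚ.* coeff p k ℚ.+ coeff (0ℚ ∷ []) k)            ≡⟨ ℚₚ.+-identityˡ _ ⟩
  1ℚ ℚ.* coeff p k ℚ.+ coeff (0ℚ ∷ []) k                     ≡⟨ cong₂ ℚ._+_ (ℚₚ.*-identityˡ (coeff p k)) (coeff-0∷[] k) ⟩
  coeff p k ℚ.+ 0ℚ                                           ≡⟨ ℚₚ.+-identityʳ _ ⟩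
  coeff p k                                                  ∎
  where open ≡-Reasoning

coeff-X^-≢ : ∀ n k → k ≢ n → coeff (X ^ₚ n) k ≡ 0ℚ
coeff-X^-≢ zero    zero    k≢n = contradiction refl k≢n
coeff-X^-≢ zero    (suc k) _   = refl
coeff-X^-≢ (suc n) zero    _   = coeff-X-*-0 (X ^ₚ n)
coeff-X^-≢ (suc n) (suc k) k≢n = trans (coeff-X-*-suc (X ^ₚ n) k) (coeff-X^-≢ n k (k≢n ∘ cong suc))

coeff-X^-n : ∀ n → coeff (X ^ₚ n) n ≡ 1ℚ
coeff-X^-n zero    = refl
coeff-X^-n (suc n) = trans (coeff-X-*-suc (X ^ₚ n) n) (coeff-X^-n n)

L : Poly
L = C 1ℚ +ₚ -ₚ X

coeff-L-*-0 : ∀ p → coeff (L *ₚ p) 0 ≡ coeff p 0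
coeff-L-*-0 p = trans (coeff-∷-* 1ℚ (ℚ.- 1ℚ ∷ []) p 0) (trans (ℚₚ.+-identityʳ _) (ℚₚ.*-identityˡ (coeff p 0)))

coeff-L-*-suc : ∀ p k → coeff (L *ₚ p) (suc k) ≡ coeff p (suc k) ℚ.- coeff p k
coeff-L-*-suc p k = begin
  coeff (L *ₚ p) (suc k)                                            ≡⟨ coeff-∷-* 1ℚ (ℚ.- 1ℚ ∷ []) p (suc k) ⟩
  1ℚ ℚ.* coeff p (suc k) ℚ.+ coeff ((ℚ.- 1ℚ ∷ []) *ₚ p) k           ≡⟨ cong₂ ℚ._+_ (ℚₚ.*-identityˡ (coeff p (suc k))) (coeff-∷-* (ℚ.- 1ℚ) [] p k) ⟩
  coeff p (suc k) ℚ.+ (ℚ.- 1ℚ ℚ.* coeff p k ℚ.+ coeff (0ℚ ∷ []) k)  ≡⟨ cong (coeff p (suc k) ℚ.+_) (cong₂ ℚ._+_ (-1*p≡-p (coeff p k)) (coeff-0∷[] k)) ⟩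
  coeff p (suc k) ℚ.+ (ℚ.- coeff p k ℚ.+ 0ℚ)                        ≡⟨ cong (coeff p (suc k) ℚ.+_) (ℚₚ.+-identityʳ _) ⟩
  coeff p (suc k) ℚ.- coeff p k                                     ∎
  where open ≡-Reasoning

coeff-L^-0 : ∀ n → coeff (L ^ₚ n) 0 ≡ 1ℚ
coeff-L^-0 zero    = refl
coeff-L^-0 (suc n) = trans (coeff-L-*-0 (L ^ₚ n)) (coeff-L^-0 n)

coeff-L^-> : ∀ n k → n < k → coeff (L ^ₚ n) k ≡ 0ℚ
coeff-L^-> zero    (suc k) _         = refl
coeff-L^-> (suc n) (suc k) (s≤s n<k) = begin
  coeff (L ^ₚ suc n) (suc k)                  ≡⟨ coeff-L-*-suc (L ^ₚ n) k ⟩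
  coeff (L ^ₚ n) (suc k) ℚ.- coeff (L ^ₚ n) k ≡⟨ cong₂ ℚ._-_ (coeff-L^-> n (suc k) (ℕₚ.m<n⇒m<1+n n<k)) (coeff-L^-> n k n<k) ⟩
  0ℚ ℚ.- 0ℚ                                   ≡⟨⟩
  0ℚ                                          ∎
  where open ≡-Reasoning

coeff-L^-n : ∀ n → coeff (L ^ₚ n) n ≡ (ℚ.- 1ℚ) ^ n
coeff-L^-n zero    = refl
coeff-L^-n (suc n) = begin
  coeff (L ^ₚ suc n) (suc n)                  ≡⟨ coeff-L-*-suc (L ^ₚ n) n ⟩
  coeff (L ^ₚ n) (suc n) ℚ.- coeff (L ^ₚ n) n ≡⟨ cong₂ ℚ._-_ (coeff-L^-> n (suc n) ℕₚ.≤-refl) (coeff-L^-n n) ⟩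
  0ℚ ℚ.- (ℚ.- 1ℚ) ^ n                          ≡⟨ ℚₚ.+-identityˡ _ ⟩
  ℚ.- (ℚ.- 1ℚ) ^ n                             ≡⟨ -1*p≡-p _ ⟨
  (ℚ.- 1ℚ) ^ suc n                             ∎
  where open ≡-Reasoning

fromℤ-suc : ∀ n → fromℤ (+ suc n) ≡ 1ℚ ℚ.+ fromℤ (+ n)
fromℤ-suc n = ℚₚ.toℚᵘ-injective (ℚᵘₚ.≃-trans (*≡* (numerators (+ n))) (ℚᵘₚ.≃-sym (ℚₚ.toℚᵘ-homo-+ 1ℚ (fromℤ (+ n)))))
  where
  numerators : ∀ n → (1ℤ ℤ.+ n) ℤ.* 1ℤ ≡ (1ℤ ℤ.* 1ℤ ℤ.+ n ℤ.* 1ℤ) ℤ.* 1ℤ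
  numerators = solve-∀

coeff-L^-pred : ∀ m → coeff (L ^ₚ suc m) m ≡ (ℚ.- 1ℚ) ^ m ℚ.* fromℤ (+ suc m)
coeff-L^-pred zero    = coeff-L^-0 1
coeff-L^-pred (suc m) = begin
  coeff (L ^ₚ suc (suc m)) (suc m)                          ≡⟨ coeff-L-*-suc (L ^ₚ suc m) m ⟩
  coeff (L ^ₚ suc m) (suc m) ℚ.- coeff (L ^ₚ suc m) m       ≡⟨ cong₂ ℚ._-_ (coeff-L^-n (suc m)) (coeff-L^-pred m) ⟩
  σ′ ℚ.- σ ℚ.* i                                             ≡⟨ cong (σ′ ℚ.+_) (trans (ℚₚ.neg-distribˡ-* σ i) (cong (ℚ._* i) (sym (-1*p≡-p σ)))) ⟩
  σ′ ℚ.+ σ′ ℚ.* i                                            ≡⟨ cong (ℚ._+ σ′ ℚ.* i) (ℚₚ.*-identityʳ σ′) ⟨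
  σ′ ℚ.* 1ℚ ℚ.+ σ′ ℚ.* i                                     ≡⟨ ℚₚ.*-distribˡ-+ σ′ 1ℚ i ⟨
  σ′ ℚ.* (1ℚ ℚ.+ i)                                          ≡⟨ cong (σ′ ℚ.*_) (fromℤ-suc (suc m)) ⟨
  σ′ ℚ.* fromℤ (+ suc (suc m))                               ∎
  where
  open ≡-Reasoning
  σ σ′ i : ℚ
  σ = (ℚ.- 1ℚ) ^ m
  σ′ = (ℚ.- 1ℚ) ^ suc m
  i = fromℤ (+ suc m)

sign-even : ∀ m → (ℚ.- 1ℚ) ^ (m + m) ≡ 1ℚ
sign-even zero    = refl
sign-even (suc m) = begin
  (ℚ.- 1ℚ) ^ suc (m + suc m)                      ≡⟨ cong (λ k → (ℚ.- 1ℚ) ^ suc k) (ℕₚ.+-suc m m) ⟩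
  ℚ.- 1ℚ ℚ.* (ℚ.- 1ℚ ℚ.* (ℚ.- 1ℚ) ^ (m + m))      ≡⟨ cong (λ x → ℚ.- 1ℚ ℚ.* (ℚ.- 1ℚ ℚ.* x)) (sign-even m) ⟩
  1ℚ                                              ∎
  where open ≡-Reasoning

coeff-K : ∀ a n k → coeff (K a n) k ≡ coeff (X ^ₚ n) k ℚ.+ coeff (L ^ₚ n) k ℚ.+ coeff (C (a ^ n)) k
coeff-K a n k = trans (coeff-+ (X ^ₚ n +ₚ L ^ₚ n) (C (a ^ n)) k) (cong (ℚ._+ coeff (C (a ^ n)) k) (coeff-+ (X ^ₚ n) (L ^ₚ n) k))

vanish-K : ∀ a n k → n < k → coeff (K a n) k ≡ 0ℚ
vanish-K a n k@(suc _) n<k = begin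
  coeff (K a n) k                                   ≡⟨ coeff-K a n k ⟩
  coeff (X ^ₚ n) k ℚ.+ coeff (L ^ₚ n) k ℚ.+ 0ℚ      ≡⟨ cong₂ (λ x y → x ℚ.+ y ℚ.+ 0ℚ) (coeff-X^-≢ n k (ℕₚ.>⇒≢ n<k)) (coeff-L^-> n k n<k) ⟩
  0ℚ                                                ∎
  where open ≡-Reasoning

constant-K : ∀ a n → 1 ≤ n → coeff (K a n) 0 ≡ a ^ n ℚ.+ 1ℚ
constant-K a n 1≤n = begin
  coeff (K a n) 0                                   ≡⟨ coeff-K a n 0 ⟩
  coeff (X ^ₚ n) 0 ℚ.+ coeff (L ^ₚ n) 0 ℚ.+ a ^ n   ≡⟨ cong₂ (λ x y → x ℚ.+ y ℚ.+ a ^ n) (coeff-X^-≢ n 0 (ℕₚ.<⇒≢ 1≤n)) (coeff-L^-0 n) ⟩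
  0ℚ ℚ.+ 1ℚ ℚ.+ a ^ n                               ≡⟨ ℚₚ.+-comm 1ℚ (a ^ n) ⟩
  a ^ n ℚ.+ 1ℚ                                      ∎
  where open ≡-Reasoning

top-K : ∀ a n → 1 ≤ n → coeff (K a n) n ≡ 1ℚ ℚ.+ (ℚ.- 1ℚ) ^ n
top-K a n@(suc _) _ = begin
  coeff (K a n) n                                   ≡⟨ coeff-K a n n ⟩
  coeff (X ^ₚ n) n ℚ.+ coeff (L ^ₚ n) n ℚ.+ 0ℚ      ≡⟨ cong₂ (λ x y → x ℚ.+ y ℚ.+ 0ℚ) (coeff-X^-n n) (coeff-L^-n n) ⟩
  1ℚ ℚ.+ (ℚ.- 1ℚ) ^ n ℚ.+ 0ℚ                        ≡⟨ ℚₚ.+-identityʳ _ ⟩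
  1ℚ ℚ.+ (ℚ.- 1ℚ) ^ n                               ∎
  where open ≡-Reasoning

pred-K : ∀ a N → 1 ≤ N → coeff (K a (suc N)) N ≡ (ℚ.- 1ℚ) ^ N ℚ.* fromℤ (+ suc N)
pred-K a N@(suc _) _ = begin
  coeff (K a (suc N)) N                             ≡⟨ coeff-K a (suc N) N ⟩
  coeff (X ^ₚ suc N) N ℚ.+ coeff (L ^ₚ suc N) N ℚ.+ 0ℚ
    ≡⟨ cong₂ (λ x y → x ℚ.+ y ℚ.+ 0ℚ) (coeff-X^-≢ (suc N) N (ℕₚ.<⇒≢ (ℕₚ.n<1+n N))) (coeff-L^-pred N) ⟩
  0ℚ ℚ.+ (ℚ.- 1ℚ) ^ N ℚ.* fromℤ (+ suc N) ℚ.+ 0ℚ    ≡⟨ trans (ℚₚ.+-identityʳ _) (ℚₚ.+-identityˡ _) ⟩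
  (ℚ.- 1ℚ) ^ N ℚ.* fromℤ (+ suc N)                  ∎
  where open ≡-Reasoning

open Valuation 2-adic using (v)

ν-1 : ν 1 ≡ 0
ν-1 = ν-odd (0 , refl)

v-fromℤ : ∀ n → v (fromℤ (+ n)) ≡ + ν n
v-fromℤ n = trans (cong (λ d → + ν n ℤ.- + d) ν-1) (ℤₚ.+-identityʳ (+ ν n))

v-1 : v 1ℚ ≡ 0ℤ
v-1 = trans (v-fromℤ 1) (cong +_ ν-1)

v-½ : v ½ ≡ -1ℤ
v-½ = cong₂ (λ n d → + n ℤ.- + d) ν-1 (ν-2^ 1)

v--½ : v -½ ≡ -1ℤ
v--½ = cong₂ (λ n d → + n ℤ.- + d) ν-1 (ν-2^ 1)

module Plain = Weighted 2-adic 1 0ℤ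

plain-weight : ∀ x k → Plain.weight x k ≡ v x
plain-weight x k = simplify (v x) (+ k)
  where
  simplify : ∀ x k → 1ℤ ℤ.* x ℤ.+ 0ℤ ℤ.* k ≡ x
  simplify = solve-∀

Integral : ℚ → Set
Integral x = Plain.AtLeast x 0 0ℤ

integral-0 : ∀ {x} → x ≡ 0ℚ → Integral x
integral-0 {x} = Plain.zero⇒atLeast {x} {0} {0ℤ}

integral-+ : ∀ {x y} → Integral x → Integral y → Integral (x ℚ.+ y)
integral-+ {x} {y} = Plain.atLeast-+ {x} {y} {0} {0ℤ}

integral-neg : ∀ {x} → Integral x → Integral (ℚ.- x)
integral-neg {x} = Plain.atLeast-neg {x} {0} {0ℤ}

integral-1 : Integral 1ℚ
integral-1 _ = ℤₚ.≤-reflexive (sym (trans (plain-weight 1ℚ 0) v-1))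

integral-X^ : ∀ n k → Integral (coeff (X ^ₚ n) k)
integral-X^ n k with k ℕₚ.≟ n
... | yes refl = subst Integral (sym (coeff-X^-n n)) integral-1
... | no  k≢n  = integral-0 (coeff-X^-≢ n k k≢n)

integral-L^ : ∀ n k → Integral (coeff (L ^ₚ n) k)
integral-L^ zero    zero    = integral-1
integral-L^ zero    (suc k) = integral-0 refl
integral-L^ (suc n) zero    = subst Integral (sym (coeff-L-*-0 (L ^ₚ n))) (integral-L^ n 0)
integral-L^ (suc n) (suc k) = subst Integral (sym (coeff-L-*-suc (L ^ₚ n) k))
  (integral-+ (integral-L^ n (suc k)) (integral-neg (integral-L^ n k)))

integral-K : ∀ a n k → 0 < k → coeff (K a n) k ≢ 0ℚ → 0ℤ ℤ.≤ v (coeff (K a n) k)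
integral-K a n (suc k) _ Kₖ≢0 = subst (0ℤ ℤ.≤_) (plain-weight (coeff (K a n) (suc k)) 0)
  (subst Integral (sym (coeff-K a n (suc k)))
    (integral-+ (integral-+ (integral-X^ n (suc k)) (integral-L^ n (suc k))) (integral-0 refl)) Kₖ≢0)

module _ {a : ℚ} (a≡±½ : a ≡ ½ ⊎ a ≡ -½) where

  a^-exact : ∀ n → Plain.Exactly (a ^ n) 0 (ℤ.- (+ n))
  a^-exact zero    = (λ ()) , trans (plain-weight 1ℚ 0) v-1
  a^-exact (suc n) = subst (Plain.Exactly (a ^ suc n) 0) (-1-n≡-[1+n] (+ n))
                       (Plain.exactly-* {a} {a ^ n} {0} {0} a-exact (a^-exact n))
    where
    -1-n≡-[1+n] : ∀ n → -1ℤ ℤ.+ ℤ.- n ≡ ℤ.- (1ℤ ℤ.+ n)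
    -1-n≡-[1+n] = solve-∀
    a-exact : Plain.Exactly a 0 -1ℤ
    a-exact = [ (λ a≡½  → subst (λ x → Plain.Exactly x 0 -1ℤ) (sym a≡½)  ((λ ()) , trans (plain-weight ½ 0) v-½))
              , (λ a≡-½ → subst (λ x → Plain.Exactly x 0 -1ℤ) (sym a≡-½) ((λ ()) , trans (plain-weight -½ 0) v--½)) ]′ a≡±½

  constant-K-exact : ∀ n → 1 ≤ n → coeff (K a n) 0 ≢ 0ℚ × v (coeff (K a n) 0) ≡ ℤ.- (+ n)
  constant-K-exact n@(suc n′) _ = subst (λ x → x ≢ 0ℚ × v x ≡ ℤ.- (+ n)) (sym (constant-K a n (s≤s z≤n)))
    (proj₁ exact , trans (sym (plain-weight (a ^ n ℚ.+ 1ℚ) 0)) (proj₂ exact))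
    where
    1>-n : Plain.AtLeast 1ℚ 0 (ℤ.suc (ℤ.- (+ n)))
    1>-n _ = ℤₚ.≤-trans (ℤₚ.≤-reflexive (ℤₚ.1-[1+n]≡-n n′))
               (ℤₚ.≤-trans (ℤₚ.neg-≤-pos {n′} {0}) (ℤₚ.≤-reflexive (sym (trans (plain-weight 1ℚ 0) v-1))))
    exact : Plain.Exactly (a ^ n ℚ.+ 1ℚ) 0 (ℤ.- (+ n))
    exact = Plain.exactly-+ {a ^ n} {1ℚ} {0} (a^-exact n) 1>-n

  irreducible-even : ∀ m → 1 ≤ m + m → Irreducible (K a (m + m))
  irreducible-even m 1≤n = Dumas.dumas-irreducible 2-adic n
    (Dumas.dumasCondition 2-adic n (K a n) 1≤n ℕₚ.≤-refl (proj₁ K₀) (proj₂ K₀) (integral-K a n) Kₙ≢0 vKₙ (vanish-K a n))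
    where
    n : ℕ
    n = m + m
    K₀ : coeff (K a n) 0 ≢ 0ℚ × v (coeff (K a n) 0) ≡ ℤ.- (+ n)
    K₀ = constant-K-exact n 1≤n
    Kₙ≡2 : coeff (K a n) n ≡ fromℤ (+ 2)
    Kₙ≡2 = trans (top-K a n 1≤n) (cong (1ℚ ℚ.+_) (sign-even m))
    Kₙ≢0 : coeff (K a n) n ≢ 0ℚ
    Kₙ≢0 Kₙ≡0 with trans (sym Kₙ≡2) Kₙ≡0
    ... | ()
    vKₙ : v (coeff (K a n) n) ℤ.+ + n ≡ + suc n
    vKₙ = cong (ℤ._+ + n) (trans (cong v Kₙ≡2) (trans (v-fromℤ 2) (cong +_ (ν-2^ 1))))

  irreducible-odd : ∀ m → 1 ≤ m + m → Irreducible (K a (suc (m + m)))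
  irreducible-odd m 1≤N = Dumas.dumas-irreducible 2-adic N
    (Dumas.dumasCondition 2-adic N (K a n) 1≤N (ℕₚ.n≤1+n N) (proj₁ K₀) (proj₂ K₀) (integral-K a n) Kₙ₋₁≢0 vKₙ₋₁ vanish)
    where
    N n : ℕ
    N = m + m
    n = suc N
    K₀ : coeff (K a n) 0 ≢ 0ℚ × v (coeff (K a n) 0) ≡ ℤ.- (+ n)
    K₀ = constant-K-exact n (s≤s z≤n)
    Kₙ₋₁≡n : coeff (K a n) N ≡ fromℤ (+ n)
    Kₙ₋₁≡n = trans (pred-K a N 1≤N) (trans (cong (ℚ._* fromℤ (+ n)) (sign-even m)) (ℚₚ.*-identityˡ _))
    Kₙ₋₁≢0 : coeff (K a n) N ≢ 0ℚ
    Kₙ₋₁≢0 Kₙ₋₁≡0 with trans (sym Kₙ₋₁≡n) Kₙ₋₁≡0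
    ... | ()
    vKₙ₋₁ : v (coeff (K a n) N) ℤ.+ + n ≡ + suc N
    vKₙ₋₁ = cong (ℤ._+ + n) (trans (cong v Kₙ₋₁≡n) (trans (v-fromℤ n) (cong +_ (ν-odd (m , refl)))))
    vanish : ∀ k → N < k → coeff (K a n) k ≡ 0ℚ
    vanish k N<k with k ℕₚ.≟ n
    ... | yes refl = trans (top-K a n (s≤s z≤n)) (cong (λ x → 1ℚ ℚ.+ ℚ.- 1ℚ ℚ.* x) (sign-even m))
    ... | no  k≢n  = vanish-K a n k (ℕₚ.≤∧≢⇒< N<k (k≢n ∘ sym))

mainTheorem8 : (a : ℚ) → (a ≡ ½ ⊎ a ≡ -½) → (n : ℕ) → 2 ≤ n → Irreducible (K a n)
mainTheorem8 a a≡±½ n 2≤n with even⊎odd n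
... | inj₁ (m , refl) = irreducible-even a≡±½ m (ℕₚ.≤-trans (s≤s z≤n) 2≤n)
... | inj₂ (m , refl) = irreducible-odd a≡±½ m (ℕₚ.≤-pred 2≤n)
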